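{- Every doubly fractal sequence is a signature sequence: if $S$ is a doubly fractal sequence, then there exists a positive real number $\theta$ such that $S=S_\theta$.
   Context: All sequences are sequences $S=(s_1,s_2,\ldots)$ of positive integers. Suppose every positive integer occurs in $S$. The upper trimmed subsequence $\wedge_S$ is the sequence that remains after the first occurrence of every positive integer is removed from $S$. The lower trimmed subsequence $\vee_S$ is the sequence that remains after $1$ is subtracted from every term of $S$ and then all terms equal to $0$ are removed. $S$ is doubly fractal if $s_1=1$ and $\wedge_S=\vee_S=S$. For a positive real $\theta$, let $M_\theta$ be the multiset $\{i+j\theta : i,j\in\mathbb{N}\}$ ($\mathbb{N}$ the positive integers), arranged in nondecreasing order (repeated values, which occur exactly when $\theta$ is rational, listed with multiplicity) as $(t_h+a_h\theta)_{h\ge1}$ with $t_h,a_h\in\mathbb{N}$; the signature sequence of $\theta$ is $S_\theta=(t_1,t_2,t_3,\ldots)$. -}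

module Defs where

open import Data.Nat using (ℕ; zero; suc; _≤_; _<_; _∸_)
open import Data.Integer as ℤ using (ℤ; +_; -[1+_]; _-_)
open import Data.Rational as ℚ using (ℚ; _/_; 0ℚ)
open import Data.Product using (Σ; ∃; _×_; _,_; ∃-syntax)
open import Data.Sum using (_⊎_)
open import Data.Empty using (⊥)
open import Relation.Nullary using (¬_)
open import Relation.Binary.PropositionalEquality using (_≡_)

-- Sequences: a sequence S = (s₁, s₂, …) is a function S : ℕ → ℕ with
-- S 0 = s₁, S 1 = s₂, …  (0-based indexing).

AllOccur : (ℕ → ℕ) → Set
AllOccur S = ∀ (k : ℕ) → 1 ≤ k → ∃[ h ] S h ≡ k

StrictlyIncreasing : (ℕ → ℕ) → Set
StrictlyIncreasing f = ∀ m n → m < n → f m < f n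

Enumerates : (ℕ → Set) → (ℕ → ℕ) → Set
Enumerates P f = StrictlyIncreasing f × (∀ n → P (f n)) × (∀ h → P h → ∃[ n ] f n ≡ h)

NotFirstOcc : (ℕ → ℕ) → ℕ → Set
NotFirstOcc S h = ∃[ h' ] (h' < h × S h' ≡ S h)

IsUpperTrimmed : (ℕ → ℕ) → (ℕ → ℕ) → Set
IsUpperTrimmed S T = ∃[ f ] (Enumerates (NotFirstOcc S) f × (∀ n → T n ≡ S (f n)))

IsLowerTrimmed : (ℕ → ℕ) → (ℕ → ℕ) → Set
IsLowerTrimmed S T = ∃[ f ] (Enumerates (λ h → 2 ≤ S h) f × (∀ n → T n ≡ S (f n) ∸ 1))

DoublyFractal : (ℕ → ℕ) → Set
DoublyFractal S =
  (∀ n → 1 ≤ S n) × AllOccur S × S 0 ≡ 1 × IsUpperTrimmed S S × IsLowerTrimmed S S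

-- Positive real numbers, as two-sided Dedekind cuts of ℚ.
-- lower q means q < θ, upper q means θ < q.

record PosReal : Set₁ where
  field
    lower      : ℚ → Set
    upper      : ℚ → Set
    lower-inh  : ∃[ q ] lower q
    upper-inh  : ∃[ q ] upper q
    lower-down : ∀ p q → p ℚ.< q → lower q → lower p
    lower-open : ∀ q → lower q → ∃[ r ] (q ℚ.< r × lower r)
    upper-up   : ∀ p q → p ℚ.< q → upper p → upper q
    upper-open : ∀ q → upper q → ∃[ r ] (r ℚ.< q × upper r)
    disjoint   : ∀ q → lower q → upper q → ⊥
    located    : ∀ p q → p ℚ.< q → lower p ⊎ upper q
    positive   : lower 0ℚ

open PosReal public

-- c ≤ d·θ  for integers c, d
--   d > 0 :  c/d ≤ θ   i.e. not (θ < c/d)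
--   d = 0 :  c ≤ 0
--   d < 0 :  θ ≤ (-c)/|d|   i.e. not ((-c)/|d| < θ)
LeMul : PosReal → ℤ → ℤ → Set
LeMul θ c (+ zero)    = c ℤ.≤ + 0
LeMul θ c (+ suc n)   = ¬ upper θ (c / suc n)
LeMul θ c -[1+ n ]    = ¬ lower θ ((ℤ.- c) / suc n)

-- t + a·θ ≤ t' + a'·θ   (as real numbers)
LeVal : PosReal → ℕ × ℕ → ℕ × ℕ → Set
LeVal θ (t , a) (t' , a') = LeMul θ ((+ t) - (+ t')) ((+ a') - (+ a))

-- S is the signature sequence S_θ: the multiset {i + jθ : i,j ≥ 1} is
-- arranged (with multiplicity) in nondecreasing order as
-- (t_h + a_h θ)_h, i.e. h ↦ (t h , a h) is a bijection from indices onto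
-- ℕ⁺ × ℕ⁺ with nondecreasing values, and S h = t h.
IsSignatureSeq : PosReal → (ℕ → ℕ) → Set
IsSignatureSeq θ S =
  Σ (ℕ → ℕ) λ t → Σ (ℕ → ℕ) λ a →
    (∀ h → 1 ≤ t h × 1 ≤ a h)
  × (∀ h h' → t h ≡ t h' → a h ≡ a h' → h ≡ h')
  × (∀ i j → 1 ≤ i → 1 ≤ j → ∃[ h ] (t h ≡ i × a h ≡ j))
  × (∀ h h' → h ≤ h' → LeVal θ (t h , a h) (t h' , a h'))
  × (∀ h → S h ≡ t h)

-- Let f and g enumerate the positions kept by the upper and the lower trimming. Writing
-- P i j for the (j+1)-st occurrence of the value i+1, the identity ∧_S = S says that f
-- moves P i j to P i (j+1), and ∨_S = S says that g moves P i j to P (i+1) j. So the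
-- positions form a grid on which the order of positions is invariant under translation
-- (f and g are strictly increasing), hence additive, and
-- θ = sup { c/d : P c 0 ≤ P 0 d } is a positive real for which position P i j precedes
-- P i' j' only if i + jθ ≤ i' + j'θ.
module Submission where

open import Defs
open import Data.Nat using (ℕ)
open import Data.Product using (∃-syntax)

open import Data.Nat using (zero; suc; _+_; _*_; _∸_; _≤_; _<_; z≤n; s≤s; _≟_)
open import Data.Nat using (compare; less; equal; greater)
open import Data.Nat.Properties
open import Data.Nat.Induction using (<-rec)
open import Data.Integer as ℤ using (+_; -[1+_]; _⊖_; 0ℤ)
import Data.Integer.Properties as ℤP
open import Data.Rational as ℚ using (ℚ; mkℚ; _/_; 0ℚ)
import Data.Rational.Properties as ℚP
import Data.Rational.Unnormalised as ℚᵘ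
import Data.Rational.Unnormalised.Properties as ℚᵘP
open import Data.Product using (_×_; _,_; proj₁; proj₂; uncurry)
open import Data.Sum using (_⊎_; inj₁; inj₂)
open import Data.Empty using (⊥)
open import Function using (_∘′_)
open import Relation.Binary using (tri<; tri≈; tri>)
open import Relation.Binary.PropositionalEquality
open import Relation.Nullary using (¬_; yes; no; contradiction)

strictlyIncreasing-suc : ∀ {φ : ℕ → ℕ} → (∀ n → φ n < φ (suc n)) → StrictlyIncreasing φ
strictlyIncreasing-suc φ-suc m (suc n) (s≤s m≤n) with m≤n⇒m<n∨m≡n m≤n
... | inj₁ m<n  = <-trans (strictlyIncreasing-suc φ-suc m n m<n) (φ-suc n)
... | inj₂ refl = φ-suc n

module Increasing {φ : ℕ → ℕ} (φ-inc : StrictlyIncreasing φ) where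

  mono-≤ : ∀ {m n} → m ≤ n → φ m ≤ φ n
  mono-≤ {m} {n} m≤n with m≤n⇒m<n∨m≡n m≤n
  ... | inj₁ m<n  = <⇒≤ (φ-inc m n m<n)
  ... | inj₂ refl = ≤-refl

  cancel-≤ : ∀ {m n} → φ m ≤ φ n → m ≤ n
  cancel-≤ {m} {n} φm≤φn = ≮⇒≥ (λ n<m → <⇒≱ (φ-inc n m n<m) φm≤φn)

  cancel-< : ∀ {m n} → φ m < φ n → m < n
  cancel-< φm<φn = ≰⇒> (λ n≤m → <⇒≱ φm<φn (mono-≤ n≤m))

  injective : ∀ {m n} → φ m ≡ φ n → m ≡ n
  injective e = ≤-antisym (cancel-≤ (≤-reflexive e)) (cancel-≤ (≤-reflexive (sym e)))

  inflationary : ∀ n → n ≤ φ n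
  inflationary zero    = z≤n
  inflationary (suc n) = ≤-<-trans (inflationary n) (φ-inc n (suc n) ≤-refl)

  strictlyInflationary : 0 < φ 0 → ∀ n → n < φ n
  strictlyInflationary φ0>0 zero    = φ0>0
  strictlyInflationary φ0>0 (suc n) =
    ≤-<-trans (strictlyInflationary φ0>0 n) (φ-inc n (suc n) ≤-refl)

  onto⇒deflationary : (∀ n → ∃[ m ] φ m ≡ n) → ∀ n → φ n ≤ n
  onto⇒deflationary onto zero with onto zero
  ... | m , φm≡0 = subst (φ zero ≤_) φm≡0 (mono-≤ z≤n)
  onto⇒deflationary onto (suc n) with onto (suc n)
  ... | m , φm≡1+n = subst (φ (suc n) ≤_) φm≡1+n (mono-≤ n<m)
    where
    n<m : n < m
    n<m = cancel-< (≤-<-trans (onto⇒deflationary onto n) (subst (n <_) (sym φm≡1+n) ≤-refl))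

  onto⇒id : (∀ n → ∃[ m ] φ m ≡ n) → ∀ n → φ n ≡ n
  onto⇒id onto n = ≤-antisym (onto⇒deflationary onto n) (inflationary n)

m≤n⇒m⊖n≤0 : ∀ {m n} → m ≤ n → m ⊖ n ℤ.≤ 0ℤ
m≤n⇒m⊖n≤0 {m} {n} m≤n = subst (m ⊖ n ℤ.≤_) (ℤP.n⊖n≡0 m) (ℤP.⊖-monoʳ-≥-≤ m m≤n)

m+n⊖m≡n : ∀ m n → m + n ⊖ m ≡ + n
m+n⊖m≡n m n = trans (ℤP.⊖-≥ (m≤m+n m n)) (cong +_ (m+n∸m≡n m n))

[1+m+n]⊖m≡1+n : ∀ m n → suc (m + n) ⊖ m ≡ + suc n
[1+m+n]⊖m≡1+n m n = trans (cong (_⊖ m) (sym (+-suc m n))) (m+n⊖m≡n m (suc n))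

m⊖[1+m+n]≡-[1+n] : ∀ m n → m ⊖ suc (m + n) ≡ -[1+ n ]
m⊖[1+m+n]≡-[1+n] m n = trans (ℤP.⊖-swap m (suc (m + n))) (cong ℤ.-_ ([1+m+n]⊖m≡1+n m n))

-- i / suc d is fromℚᵘ (mkℚᵘ i d) by definition.
*<*⇒/< : ∀ i j d e → i ℤ.* + suc e ℤ.< j ℤ.* + suc d → i / suc d ℚ.< j / suc e
*<*⇒/< i j d e lt = ℚP.toℚᵘ-cancel-<
  (ℚᵘP.<-respʳ-≃ (ℚᵘP.≃-sym (ℚP.toℚᵘ-fromℚᵘ (ℚᵘ.mkℚᵘ j e)))
    (ℚᵘP.<-respˡ-≃ (ℚᵘP.≃-sym (ℚP.toℚᵘ-fromℚᵘ (ℚᵘ.mkℚᵘ i d))) (ℚᵘ.*<* lt)))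

/<⇒*<* : ∀ i j d e → i / suc d ℚ.< j / suc e → i ℤ.* + suc e ℤ.< j ℤ.* + suc d
/<⇒*<* i j d e lt = ℚᵘP.drop-*<*
  (ℚᵘP.<-respʳ-≃ (ℚP.toℚᵘ-fromℚᵘ (ℚᵘ.mkℚᵘ j e))
    (ℚᵘP.<-respˡ-≃ (ℚP.toℚᵘ-fromℚᵘ (ℚᵘ.mkℚᵘ i d)) (ℚP.toℚᵘ-mono-< lt)))

upper⇒positive : ∀ (θ : PosReal) {q} → upper θ q → 0ℚ ℚ.< q
upper⇒positive θ {q} up with ℚP.<-cmp q 0ℚ
... | tri< q<0 _ _ = contradiction up (disjoint θ q (lower-down θ q 0ℚ q<0 (positive θ)))
... | tri≈ _ refl _ = contradiction up (disjoint θ 0ℚ (positive θ))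
... | tri> _ _ 0<q = 0<q

module ShiftInvariantGrid
  (P : ℕ → ℕ → ℕ)
  {σ τ : ℕ → ℕ} (σ-inc : StrictlyIncreasing σ) (τ-inc : StrictlyIncreasing τ)
  (σ-inflationary : ∀ n → n < σ n) (τ-inflationary : ∀ n → n < τ n)
  (σ-P : ∀ i j → σ (P i j) ≡ P (suc i) j) (τ-P : ∀ i j → τ (P i j) ≡ P i (suc j))
  where

  P-inc₁ : ∀ j → StrictlyIncreasing (λ i → P i j)
  P-inc₁ j = strictlyIncreasing-suc (λ i → subst (P i j <_) (σ-P i j) (σ-inflationary (P i j)))

  P-inc₂ : ∀ i → StrictlyIncreasing (P i)
  P-inc₂ i = strictlyIncreasing-suc (λ j → subst (P i j <_) (τ-P i j) (τ-inflationary (P i j)))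

  -- (x , y) ≼ (x' , y') models  x + y θ ≤ x' + y' θ.
  record _≼_ (u v : ℕ × ℕ) : Set where
    constructor mk≼
    field labels-≤ : uncurry P u ≤ uncurry P v

  infix 4 _≼_

  _⊕_ : ℕ × ℕ → ℕ × ℕ → ℕ × ℕ
  (x , y) ⊕ (x' , y') = x + x' , y + y'

  _·_ : ℕ → ℕ × ℕ → ℕ × ℕ
  n · (x , y) = n * x , n * y

  ⊕-comm : ∀ u v → u ⊕ v ≡ v ⊕ u
  ⊕-comm (x , y) (x' , y') = cong₂ _,_ (+-comm x x') (+-comm y y')

  ≼-refl : ∀ {u} → u ≼ u
  ≼-refl = mk≼ ≤-refl

  ≼-trans : ∀ {u v w} → u ≼ v → v ≼ w → u ≼ w
  ≼-trans (mk≼ u≤v) (mk≼ v≤w) = mk≼ (≤-trans u≤v v≤w)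

  ≼-total : ∀ u v → u ≼ v ⊎ v ≼ u
  ≼-total (x , y) (x' , y') with ≤-total (P x y) (P x' y')
  ... | inj₁ le = inj₁ (mk≼ le)
  ... | inj₂ ge = inj₂ (mk≼ ge)

  ≼-column⇒≤ : ∀ {x x' y} → (x , y) ≼ (x' , y) → x ≤ x'
  ≼-column⇒≤ {y = y} (mk≼ le) = Increasing.cancel-≤ (P-inc₁ y) le

  dominating⇒¬≼ : ∀ {x y x' y'} → x' ≤ x → y' < y → ¬ (x , y) ≼ (x' , y')
  dominating⇒¬≼ {x} {y} {x'} {y'} x'≤x y'<y (mk≼ le) = <⇒≱
    (≤-<-trans (Increasing.mono-≤ (P-inc₁ y') x'≤x) (P-inc₂ x y' y y'<y)) le

  ≼-σ : ∀ {x y x' y'} → (x , y) ≼ (x' , y') → (suc x , y) ≼ (suc x' , y')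
  ≼-σ (mk≼ le) = mk≼ (subst₂ _≤_ (σ-P _ _) (σ-P _ _) (Increasing.mono-≤ σ-inc le))

  ≼-τ : ∀ {x y x' y'} → (x , y) ≼ (x' , y') → (x , suc y) ≼ (x' , suc y')
  ≼-τ (mk≼ le) = mk≼ (subst₂ _≤_ (τ-P _ _) (τ-P _ _) (Increasing.mono-≤ τ-inc le))

  ≼-σ⁻¹ : ∀ {x y x' y'} → (suc x , y) ≼ (suc x' , y') → (x , y) ≼ (x' , y')
  ≼-σ⁻¹ (mk≼ le) = mk≼ (Increasing.cancel-≤ σ-inc (subst₂ _≤_ (sym (σ-P _ _)) (sym (σ-P _ _)) le))

  ≼-τ⁻¹ : ∀ {x y x' y'} → (x , suc y) ≼ (x' , suc y') → (x , y) ≼ (x' , y')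
  ≼-τ⁻¹ (mk≼ le) = mk≼ (Increasing.cancel-≤ τ-inc (subst₂ _≤_ (sym (τ-P _ _)) (sym (τ-P _ _)) le))

  ≼-translate : ∀ w {u v} → u ≼ v → w ⊕ u ≼ w ⊕ v
  ≼-translate (zero  , zero)  u≼v = u≼v
  ≼-translate (zero  , suc l) u≼v = ≼-τ (≼-translate (zero , l) u≼v)
  ≼-translate (suc k , l)     u≼v = ≼-σ (≼-translate (k , l) u≼v)

  ≼-cancel : ∀ w {u v} → w ⊕ u ≼ w ⊕ v → u ≼ v
  ≼-cancel (zero  , zero)  u≼v = u≼v
  ≼-cancel (zero  , suc l) u≼v = ≼-cancel (zero , l) (≼-τ⁻¹ u≼v)
  ≼-cancel (suc k , l)     u≼v = ≼-cancel (k , l) (≼-σ⁻¹ u≼v)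

  ≼-+ : ∀ {u v u' v'} → u ≼ v → u' ≼ v' → u ⊕ u' ≼ v ⊕ v'
  ≼-+ {u} {v} {u'} u≼v u'≼v' = ≼-trans
    (subst₂ _≼_ (⊕-comm u' u) (⊕-comm u' v) (≼-translate u' u≼v))
    (≼-translate v u'≼v')

  ≼-scale : ∀ n {u v} → u ≼ v → n · u ≼ n · v
  ≼-scale zero    u≼v = ≼-refl
  ≼-scale (suc n) u≼v = ≼-+ u≼v (≼-scale n u≼v)

  -- Below c d  models  c ≤ d θ,  Above c d  models  d θ ≤ c.
  Below Above : ℕ → ℕ → Set
  Below c d = (c , 0) ≼ (0 , d)
  Above c d = (0 , d) ≼ (c , 0)

  Below-scale : ∀ n {c d} → Below c d → Below (n * c) (n * d)
  Below-scale n {c} {d} b =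
    subst₂ _≼_ (cong (n * c ,_) (*-zeroʳ n)) (cong (_, n * d) (*-zeroʳ n)) (≼-scale n b)

  Above-scale : ∀ n {c d} → Above c d → Above (n * c) (n * d)
  Above-scale n {c} {d} a =
    subst₂ _≼_ (cong (_, n * d) (*-zeroʳ n)) (cong (n * c ,_) (*-zeroʳ n)) (≼-scale n a)

  Below∧Above⇒¬< : ∀ {c d c' d'} → Below c (suc d) → Above c' (suc d') →
                   ¬ (+ c' / suc d' ℚ.< + c / suc d)
  Below∧Above⇒¬< {c} {d} {c'} {d'} b a lt = <⇒≱ c'[1+d]<c[1+d'] (begin
    c * suc d'   ≡⟨ *-comm c (suc d') ⟩
    suc d' * c   ≤⟨ ≼-column⇒≤ (≼-trans (Below-scale (suc d') b) b') ⟩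
    suc d * c'   ≡⟨ *-comm (suc d) c' ⟩
    c' * suc d   ∎)
    where
    open ≤-Reasoning
    b' : (0 , suc d' * suc d) ≼ (suc d * c' , 0)
    b' = subst (λ n → (0 , n) ≼ (suc d * c' , 0)) (*-comm (suc d) (suc d')) (Above-scale (suc d) a)
    c'[1+d]<c[1+d'] : c' * suc d < c * suc d'
    c'[1+d]<c[1+d'] = ℤP.drop‿+<+
      (subst₂ ℤ._<_ (sym (ℤP.pos-* c' (suc d))) (sym (ℤP.pos-* c (suc d')))
        (/<⇒*<* (+ c') (+ c) d' d lt))

  Lower Upper : ℚ → Set
  Lower q = ∃[ c ] ∃[ d ] (q ℚ.< + c / suc d × Below c (suc d))
  Upper q = ∃[ c ] ∃[ d ] (+ c / suc d ℚ.< q × Above c (suc d))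

  Below⇒¬Upper : ∀ {c d} → Below c (suc d) → ¬ Upper (+ c / suc d)
  Below⇒¬Upper b (_ , _ , lt , a) = Below∧Above⇒¬< b a lt

  Above⇒¬Lower : ∀ {c d} → Above c (suc d) → ¬ Lower (+ c / suc d)
  Above⇒¬Lower a (_ , _ , lt , b) = Below∧Above⇒¬< b a lt

  Lower-down : ∀ p q → p ℚ.< q → Lower q → Lower p
  Lower-down p q p<q (c , d , q<c/d , b) = c , d , ℚP.<-trans p<q q<c/d , b

  Upper-up : ∀ p q → p ℚ.< q → Upper p → Upper q
  Upper-up p q p<q (c , d , c/d<p , a) = c , d , ℚP.<-trans c/d<p p<q , a

  Lower-open : ∀ q → Lower q → ∃[ r ] (q ℚ.< r × Lower r)
  Lower-open q (c , d , q<c/d , b) with ℚP.<-dense q<c/d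
  ... | r , q<r , r<c/d = r , q<r , c , d , r<c/d , b

  Upper-open : ∀ q → Upper q → ∃[ r ] (r ℚ.< q × Upper r)
  Upper-open q (c , d , c/d<q , a) with ℚP.<-dense c/d<q
  ... | r , c/d<r , r<q = r , r<q , c , d , c/d<r , a

  Lower-Upper-disjoint : ∀ q → Lower q → Upper q → ⊥
  Lower-Upper-disjoint q (c , d , q<c/d , b) up = Below⇒¬Upper b (Upper-up q _ q<c/d up)

  Lower-0 : Lower 0ℚ
  Lower-0 = 1 , P 1 0 , *<*⇒/< (+ 0) (+ 1) 0 (P 1 0) (ℤ.+<+ (s≤s z≤n)) , mk≼ P10≤P0[1+P10]
    where
    P10≤P0[1+P10] : P 1 0 ≤ P 0 (suc (P 1 0))
    P10≤P0[1+P10] =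
      <⇒≤ (≤-<-trans (Increasing.inflationary (P-inc₂ 0) (P 1 0)) (P-inc₂ 0 _ _ ≤-refl))

  Upper-inhabited : ∃[ q ] Upper q
  Upper-inhabited = + suc c / 1 , c , 0 , c/1<[1+c]/1 , mk≼ (Increasing.inflationary (P-inc₁ 0) c)
    where
    c : ℕ
    c = P 0 1
    c/1<[1+c]/1 : + c / 1 ℚ.< + suc c / 1
    c/1<[1+c]/1 = *<*⇒/< (+ c) (+ suc c) 0 0
      (subst₂ ℤ._<_ (sym (ℤP.*-identityʳ (+ c))) (sym (ℤP.*-identityʳ (+ suc c))) (ℤ.+<+ ≤-refl))

  -- A rational strictly between p and q is compared with θ by totality of ≼.
  Lower-Upper-located : ∀ p q → p ℚ.< q → Lower p ⊎ Upper q
  Lower-Upper-located p q p<q with ℚP.<-dense p<q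
  ... | r@(mkℚ (+ c) d _) , p<r , r<q with ≼-total (c , 0) (0 , suc d)
  ...   | inj₁ b = inj₁ (c , d , subst (p ℚ.<_) (sym (ℚP.↥p/↧p≡p r)) p<r , b)
  ...   | inj₂ a = inj₂ (c , d , subst (ℚ._< q) (sym (ℚP.↥p/↧p≡p r)) r<q , a)
  Lower-Upper-located p q p<q | r@(mkℚ -[1+ _ ] _ _) , p<r , _ =
    inj₁ (Lower-down p 0ℚ (ℚP.<-trans p<r (ℚP.negative⁻¹ r)) Lower-0)

  θ : PosReal
  θ = record
    { lower      = Lower
    ; upper      = Upper
    ; lower-inh  = 0ℚ , Lower-0
    ; upper-inh  = Upper-inhabited
    ; lower-down = Lower-down
    ; lower-open = Lower-open
    ; upper-up   = Upper-up
    ; upper-open = Upper-open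
    ; disjoint   = Lower-Upper-disjoint
    ; located    = Lower-Upper-located
    ; positive   = Lower-0
    }

  ≼⇒¬Upper : ∀ {x y x' k} → (x , y) ≼ (x' , suc (y + k)) → ¬ Upper ((x ⊖ x') / suc k)
  ≼⇒¬Upper {x} {y} {x'} {k} x≼x' with ≤-total x' x
  ... | inj₁ x'≤x with m≤n⇒∃[o]m+o≡n x'≤x
  ...   | e , refl rewrite m+n⊖m≡n x' e = Below⇒¬Upper (≼-cancel (x' , y) (subst₂ _≼_
          (cong (x' + e ,_) (sym (+-identityʳ y)))
          (cong₂ _,_ (sym (+-identityʳ x')) (sym (+-suc y k)))
          x≼x'))
  ≼⇒¬Upper {x} {y} {x'} {k} x≼x' | inj₂ x≤x' = ℤP.≤⇒≯ (m≤n⇒m⊖n≤0 x≤x')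
    ∘′ subst (0ℤ ℤ.<_) (ℤP.*-identityʳ (x ⊖ x'))
    ∘′ /<⇒*<* (+ 0) (x ⊖ x') 0 k
    ∘′ upper⇒positive θ

  ≼⇒¬Lower : ∀ {x y' x' k} → (x , suc (y' + k)) ≼ (x' , y') → ¬ Lower (ℤ.- (x ⊖ x') / suc k)
  ≼⇒¬Lower {x} {y'} {x'} {k} x≼x' with ≤-total x x'
  ... | inj₂ x'≤x = contradiction x≼x' (dominating⇒¬≼ x'≤x (s≤s (m≤m+n y' k)))
  ... | inj₁ x≤x' with m≤n⇒∃[o]m+o≡n x≤x'
  ...   | e , refl rewrite ℤP.⊖-swap x (x + e) | ℤP.neg-involutive (x + e ⊖ x) | m+n⊖m≡n x e =
          Above⇒¬Lower (≼-cancel (x , y') (subst₂ _≼_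
            (cong₂ _,_ (sym (+-identityʳ x)) (sym (+-suc y' k)))
            (cong (x + e ,_) (sym (+-identityʳ y')))
            x≼x'))

  ≼⇒LeMul : ∀ {x y x' y'} → (x , y) ≼ (x' , y') → LeMul θ (x ⊖ x') (y' ⊖ y)
  ≼⇒LeMul {x} {y} {x'} {y'} x≼x' with compare y y'
  ... | equal y rewrite ℤP.n⊖n≡0 y = m≤n⇒m⊖n≤0 (≼-column⇒≤ x≼x')
  ... | less y k rewrite [1+m+n]⊖m≡1+n y k = ≼⇒¬Upper x≼x'
  ... | greater y' k rewrite m⊖[1+m+n]≡-[1+n] y' k = ≼⇒¬Lower x≼x'

  ≼⇒LeVal : ∀ {x y x' y'} → (x , y) ≼ (x' , y') → LeVal θ (suc x , suc y) (suc x' , suc y')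
  ≼⇒LeVal {x} {y} {x'} {y'} x≼x'
    rewrite ℤP.[+m]-[+n]≡m⊖n (suc x) (suc x') | ℤP.[+m]-[+n]≡m⊖n (suc y') (suc y)
          | ℤP.[1+m]⊖[1+n]≡m⊖n x x' | ℤP.[1+m]⊖[1+n]≡m⊖n y' y = ≼⇒LeMul x≼x'

  isSignatureSeq : (T : ℕ → ℕ) → (∀ i j → T (P i j) ≡ suc i) →
                   (∀ h → ∃[ i ] ∃[ j ] P i j ≡ h) →
                   (∀ {i j i' j'} → P i j ≡ P i' j' → i ≡ i' × j ≡ j') →
                   IsSignatureSeq θ T
  isSignatureSeq T T-P coordinates P-injective =
    t , a , (λ _ → s≤s z≤n , s≤s z≤n) , injective , onto , ordered , T≡t
    where
    row col : ℕ → ℕ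
    row h = proj₁ (coordinates h)
    col h = proj₁ (proj₂ (coordinates h))
    P-row-col : ∀ h → P (row h) (col h) ≡ h
    P-row-col h = proj₂ (proj₂ (coordinates h))
    t a : ℕ → ℕ
    t h = suc (row h)
    a h = suc (col h)
    injective : ∀ h h' → t h ≡ t h' → a h ≡ a h' → h ≡ h'
    injective h h' th≡th' ah≡ah' = begin
      h                    ≡⟨ sym (P-row-col h) ⟩
      P (row h) (col h)    ≡⟨ cong₂ P (suc-injective th≡th') (suc-injective ah≡ah') ⟩
      P (row h') (col h')  ≡⟨ P-row-col h' ⟩
      h'                   ∎
      where open ≡-Reasoning
    onto : ∀ i j → 1 ≤ i → 1 ≤ j → ∃[ h ] (t h ≡ i × a h ≡ j)
    onto (suc i) (suc j) _ _ with P-injective (P-row-col (P i j))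
    ... | row≡i , col≡j = P i j , cong suc row≡i , cong suc col≡j
    ordered : ∀ h h' → h ≤ h' → LeVal θ (t h , a h) (t h' , a h')
    ordered h h' h≤h' = ≼⇒LeVal (mk≼ (subst₂ _≤_ (sym (P-row-col h)) (sym (P-row-col h')) h≤h'))
    T≡t : ∀ h → T h ≡ t h
    T≡t h = trans (cong T (sym (P-row-col h))) (T-P (row h) (col h))

module DoublyFractalGrid
  {S : ℕ → ℕ} (S-positive : ∀ n → 1 ≤ S n) (S-0 : S 0 ≡ 1)
  {f : ℕ → ℕ} (f-inc : StrictlyIncreasing f) (f-notFirst : ∀ n → NotFirstOcc S (f n))
  (f-onto : ∀ h → NotFirstOcc S h → ∃[ n ] f n ≡ h) (S-f : ∀ n → S n ≡ S (f n))
  {g : ℕ → ℕ} (g-inc : StrictlyIncreasing g) (g-≥2 : ∀ n → 2 ≤ S (g n))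
  (g-onto : ∀ h → 2 ≤ S h → ∃[ n ] g n ≡ h) (S-g : ∀ n → S n ≡ S (g n) ∸ 1)
  where

  S∘g : ∀ n → S (g n) ≡ suc (S n)
  S∘g n = trans (sym (m+[n∸m]≡n (≤-trans (s≤s z≤n) (g-≥2 n)))) (cong suc (sym (S-g n)))

  f-inflationary : ∀ n → n < f n
  f-inflationary = Increasing.strictlyInflationary f-inc 0<f0
    where
    0<f0 : 0 < f 0
    0<f0 with f-notFirst 0
    ... | _ , h<f0 , _ = ≤-<-trans z≤n h<f0

  g-inflationary : ∀ n → n < g n
  g-inflationary = Increasing.strictlyInflationary g-inc (n≢0⇒n>0 g0≢0)
    where
    g0≢0 : g 0 ≢ 0
    g0≢0 g0≡0 = <⇒≱ (g-≥2 0) (≤-reflexive (trans (cong S g0≡0) S-0))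

  -- P i j is the (j+1)-st occurrence of the value i+1 in S.
  P : ℕ → ℕ → ℕ
  P i       (suc j) = f (P i j)
  P zero    zero    = 0
  P (suc i) zero    = g (P i zero)

  S-P : ∀ i j → S (P i j) ≡ suc i
  S-P i       (suc j) = trans (sym (S-f (P i j))) (S-P i j)
  S-P zero    zero    = S-0
  S-P (suc i) zero    = trans (S∘g (P i zero)) (cong suc (S-P i zero))

  P-inc₂ : ∀ i → StrictlyIncreasing (P i)
  P-inc₂ i = strictlyIncreasing-suc (λ j → f-inflationary (P i j))

  P-injective : ∀ {i j i' j'} → P i j ≡ P i' j' → i ≡ i' × j ≡ j'
  P-injective {i} {j} {i'} {j'} e
    with suc-injective (trans (sym (S-P i j)) (trans (cong S e) (S-P i' j')))
  ... | refl = refl , Increasing.injective (P-inc₂ i) e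

  firstOcc⇒2≤S : ∀ h → ¬ NotFirstOcc S (suc h) → 2 ≤ S (suc h)
  firstOcc⇒2≤S h first = ≤∧≢⇒< (S-positive (suc h)) (λ 1≡Sh → first (0 , s≤s z≤n , trans S-0 1≡Sh))

  -- A first occurrence h > 0 is g m where m is again a first occurrence, hence in column 0.
  firstOcc⇒column-0 : ∀ h → ¬ NotFirstOcc S h → (∀ {m} → m < h → ∃[ i ] ∃[ j ] P i j ≡ m) →
                      ∃[ i ] P i 0 ≡ h
  firstOcc⇒column-0 zero    _     _   = 0 , refl
  firstOcc⇒column-0 (suc h) first rec with g-onto (suc h) (firstOcc⇒2≤S h first)
  ... | m , gm≡h with rec (subst (m <_) gm≡h (g-inflationary m))
  ...   | i , zero  , Pi0≡m = suc i , trans (cong g Pi0≡m) gm≡h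
  ...   | i , suc j , Pij≡m = contradiction earlier first
    where
    earlier : NotFirstOcc S (suc h)
    earlier = g (P i j)
            , subst (g (P i j) <_) (trans (cong g Pij≡m) gm≡h) (g-inc _ _ (f-inflationary (P i j)))
            , (begin
                S (g (P i j))   ≡⟨ S∘g (P i j) ⟩
                suc (S (P i j)) ≡⟨ cong suc (trans (S-f (P i j)) (cong S Pij≡m)) ⟩
                suc (S m)       ≡⟨ sym (S∘g m) ⟩
                S (g m)         ≡⟨ cong S gm≡h ⟩
                S (suc h)       ∎)
      where open ≡-Reasoning

  P-onto : ∀ h → ∃[ i ] ∃[ j ] P i j ≡ h
  P-onto = <-rec _ step
    where
    step : ∀ h → (∀ {m} → m < h → ∃[ i ] ∃[ j ] P i j ≡ m) → ∃[ i ] ∃[ j ] P i j ≡ h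
    step h rec with anyUpTo? (λ h' → S h' ≟ S h) h
    ... | no first with firstOcc⇒column-0 h first rec
    ...   | i , Pi0≡h = i , 0 , Pi0≡h
    step h rec | yes notFirst with f-onto h notFirst
    ...   | m , fm≡h with rec (subst (m <_) fm≡h (f-inflationary m))
    ...     | i , j , Pij≡m = i , suc j , trans (cong f Pij≡m) fm≡h

  row col : ℕ → ℕ
  row h = proj₁ (P-onto h)
  col h = proj₁ (proj₂ (P-onto h))

  P-row-col : ∀ h → P (row h) (col h) ≡ h
  P-row-col h = proj₂ (proj₂ (P-onto h))

  S-row : ∀ h → S h ≡ suc (row h)
  S-row h = trans (cong S (sym (P-row-col h))) (S-P (row h) (col h))

  row-of : ∀ {h i} → S h ≡ suc i → row h ≡ i
  row-of {h} Sh≡1+i = suc-injective (trans (sym (S-row h)) Sh≡1+i)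

  col-P : ∀ i j → col (P i j) ≡ j
  col-P i j = proj₂ (P-injective (P-row-col (P i j)))

  -- j ↦ col (g (P i j)) is a strictly increasing map of ℕ onto ℕ, hence the identity.
  g-P : ∀ i j → g (P i j) ≡ P (suc i) j
  g-P i j = trans (g-P-col j) (cong (P (suc i)) (Increasing.onto⇒id shift-inc shift-onto j))
    where
    shift : ℕ → ℕ
    shift j = col (g (P i j))
    g-P-col : ∀ j → g (P i j) ≡ P (suc i) (shift j)
    g-P-col j = trans (sym (P-row-col _))
      (cong (λ r → P r (shift j)) (row-of (trans (S∘g (P i j)) (cong suc (S-P i j)))))
    shift-inc : StrictlyIncreasing shift
    shift-inc j j' j<j' = Increasing.cancel-< (P-inc₂ (suc i))
      (subst₂ _<_ (g-P-col j) (g-P-col j') (g-inc _ _ (P-inc₂ i j j' j<j')))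
    shift-onto : ∀ j → ∃[ m ] shift m ≡ j
    shift-onto j with g-onto (P (suc i) j) (subst (2 ≤_) (sym (S-P (suc i) j)) (s≤s (s≤s z≤n)))
    ... | m , gm≡P = col m , (begin
      col (g (P i (col m)))        ≡⟨ cong (λ r → col (g (P r (col m)))) (sym row-m) ⟩
      col (g (P (row m) (col m)))  ≡⟨ cong (λ n → col (g n)) (P-row-col m) ⟩
      col (g m)                    ≡⟨ cong col gm≡P ⟩
      col (P (suc i) j)            ≡⟨ col-P (suc i) j ⟩
      j                            ∎)
      where
      open ≡-Reasoning
      row-m : row m ≡ i
      row-m = row-of (suc-injective (trans (sym (S∘g m)) (trans (cong S gm≡P) (S-P (suc i) j))))

theorem12 : (S : ℕ → ℕ) → DoublyFractal S → ∃[ θ ] IsSignatureSeq θ S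
-- That every value occurs is not needed: it follows from the two trimming identities.
theorem12 S (S-positive , _ , S-0 , (f , (f-inc , f-notFirst , f-onto) , S-f)
                                  , (g , (g-inc , g-≥2 , g-onto) , S-g)) =
  θ , isSignatureSeq S S-P P-onto P-injective
  where
  open DoublyFractalGrid S-positive S-0 f-inc f-notFirst f-onto S-f g-inc g-≥2 g-onto S-g
  open ShiftInvariantGrid P g-inc f-inc g-inflationary f-inflationary g-P (λ _ _ → refl)
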